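{- Let $q\in\mathbb{C}$ with $|q|<1$, $q\neq0$, and let $n\ge1$, $m\ge0$ be integers. Then for $x\in[0,1]$, $$[n]_q^m\,\mathbb{B}_{n,q}(t^m\mid x)=\sum_{k=0}^n\binom{n}{k}_q x^k\,[k]_q!\,q^{\binom{k}{2}}S(m,k:q).$$
   Context: $[x]_q=\frac{1-q^x}{1-q}$, $[n]_q!=[n]_q\cdots[1]_q$, $[0]_q!=1$, $\binom{n}{k}_q=\frac{[n]_q!}{[k]_q![n-k]_q!}$; $[0]_q^0=1$. $(1-x)_q^m=\prod_{i=1}^m(1-xq^{i-1})$. For $f\in C[0,1]$, $\mathbb{B}_{n,q}(f\mid x)=\sum_{k=0}^n f\!\left(\frac{[k]_q}{[n]_q}\right)\binom{n}{k}_q x^k(1-x)_q^{n-k}$; here $f(t)=t^m$. The second kind $q$-Stirling numbers $S(n,k:q)$ are defined by $\frac{q^{ -\binom{k}{2}}}{[k]_q!}\sum_{j=0}^k(-1)^{k-j}\binom{k}{j}_q q^{\binom{k-j}{2}}e^{[j]_qt}=\sum_{n=0}^\infty S(n,k:q)\frac{t^n}{n!}$, i.e. $S(n,k:q)=\frac{q^{ -\binom{k}{2}}}{[k]_q!}\sum_{j=0}^k(-1)^{k-j}q^{\binom{k-j}{2}}\binom{k}{j}_q[j]_q^n$. -}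

module Defs where

open import Level using (Level)
open import Data.Nat as ℕ using (ℕ; zero; suc)
open import Algebra.Bundles using (CommutativeRing)

choose2 : ℕ → ℕ
choose2 zero    = zero
choose2 (suc k) = k ℕ.+ choose2 k

-- q-calculus over a commutative ring R.
-- q  : the parameter, qi : its inverse,
-- ι n : an inverse of the q-integer [n+1]_q  (hypotheses about these are in the statement).
module QCalc {c ℓ : Level} (R : CommutativeRing c ℓ)
             (q qi : CommutativeRing.Carrier R)
             (ι : ℕ → CommutativeRing.Carrier R) where
  open CommutativeRing R hiding (zero)

  pow : Carrier → ℕ → Carrier
  pow a zero    = 1#
  pow a (suc n) = a * pow a n

  sumTo : ℕ → (ℕ → Carrier) → Carrier
  sumTo zero    f = f zero
  sumTo (suc n) f = sumTo n f + f (suc n)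

  -- [x]_q = (1 - q^x)/(1 - q) = 1 + q + ... + q^(x-1)
  qint : ℕ → Carrier
  qint zero    = 0#
  qint (suc n) = pow q n + qint n

  qfact : ℕ → Carrier
  qfact zero    = 1#
  qfact (suc n) = qint (suc n) * qfact n

  qfactInv : ℕ → Carrier
  qfactInv zero    = 1#
  qfactInv (suc n) = ι n * qfactInv n

  qbinom : ℕ → ℕ → Carrier
  qbinom n k = qfact n * (qfactInv k * qfactInv (n ℕ.∸ k))

  qfall : Carrier → ℕ → Carrier
  qfall x zero    = 1#
  qfall x (suc m) = qfall x m * (1# - x * pow q m)

  -- q-Bernstein operator applied to f(t) = t^m, n ≥ 1 (uses [n]_q^{-1} = ι (n-1))
  bernsteinPow : ℕ → ℕ → Carrier → Carrier
  bernsteinPow n m x =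
    sumTo n (λ k → pow (qint k * ι (n ℕ.∸ 1)) m * (qbinom n k * (pow x k * qfall x (n ℕ.∸ k))))

  qStirling2 : ℕ → ℕ → Carrier
  qStirling2 n k =
    (pow qi (choose2 k) * qfactInv k) *
    sumTo k (λ j → pow (- 1#) (k ℕ.∸ j) * (pow q (choose2 (k ℕ.∸ j)) * (qbinom k j * pow (qint j) n)))

-- Substituting the Gauss binomial theorem
--   (1 - x)_q^N = Σ_i binom(N,i)_q (-1)^i q^(i choose 2) x^i
-- into the Bernstein sum gives a double sum over k ≤ n and i ≤ n - k.  Collecting
-- the terms with k + i = K and using binom(n,k) binom(n-k,K-k) = binom(n,K) binom(K,k),
-- the coefficient of binom(n,K) x^K becomes
--   Σ_j (-1)^(K-j) q^((K-j) choose 2) binom(K,j)_q [j]_q^m = [K]_q! q^(K choose 2) S(m,K:q).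
module Submission where

open import Defs
open import Level using (Level)
open import Data.Nat using (ℕ; suc; _≤_)
open import Data.Nat as ℕ using (zero; _<_; _∸_; z≤n; s≤s)
import Data.Nat.Properties as ℕ
open import Data.Sum using (inj₁; inj₂)
open import Algebra.Bundles using (CommutativeRing)
open import Relation.Binary.PropositionalEquality as ≡ using (_≡_; cong)
import Algebra.Solver.Ring.NaturalCoefficients.Default as NaturalCoefficients
import Algebra.Properties.CommutativeSemiring.Exp as Exp
import Algebra.Properties.Ring as RingProperties
import Relation.Binary.Reasoning.Setoid as SetoidReasoning

module _ {c ℓ : Level} (R : CommutativeRing c ℓ)
         (q qi : CommutativeRing.Carrier R) (ι : ℕ → CommutativeRing.Carrier R) where

  open CommutativeRing R hiding (zero)
  open QCalc R q qi ι
  open Exp commutativeSemiring using (_^_; ^-homo-*; ^-distrib-*; ^-congˡ)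
  open RingProperties ring using (-1*x≈-x)
  open NaturalCoefficients commutativeSemiring using (solve; _:=_; _:+_; _:*_)
  open SetoidReasoning setoid

  sumTo-cong : ∀ n {f g : ℕ → Carrier} → (∀ k → k ≤ n → f k ≈ g k) → sumTo n f ≈ sumTo n g
  sumTo-cong zero    f≈g = f≈g 0 z≤n
  sumTo-cong (suc n) f≈g =
    +-cong (sumTo-cong n (λ k k≤n → f≈g k (ℕ.m≤n⇒m≤1+n k≤n))) (f≈g (suc n) ℕ.≤-refl)

  sumTo-distrib-+ : ∀ n (f g : ℕ → Carrier) →
                    sumTo n (λ k → f k + g k) ≈ sumTo n f + sumTo n g
  sumTo-distrib-+ zero    f g = refl
  sumTo-distrib-+ (suc n) f g = begin
    sumTo n (λ k → f k + g k) + (f (suc n) + g (suc n))  ≈⟨ +-congʳ (sumTo-distrib-+ n f g) ⟩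
    (sumTo n f + sumTo n g) + (f (suc n) + g (suc n))    ≈⟨ solve 4 (λ a b d e → (a :+ b) :+ (d :+ e) := (a :+ d) :+ (b :+ e))
                                                                    refl (sumTo n f) (sumTo n g) (f (suc n)) (g (suc n)) ⟩
    (sumTo n f + f (suc n)) + (sumTo n g + g (suc n))    ∎

  *-distribˡ-sumTo : ∀ n a (f : ℕ → Carrier) → a * sumTo n f ≈ sumTo n (λ k → a * f k)
  *-distribˡ-sumTo zero    a f = refl
  *-distribˡ-sumTo (suc n) a f = trans (distribˡ a (sumTo n f) (f (suc n))) (+-congʳ (*-distribˡ-sumTo n a f))

  sumTo-sucˡ : ∀ n (f : ℕ → Carrier) → sumTo (suc n) f ≈ f 0 + sumTo n (λ k → f (suc k))
  sumTo-sucˡ zero    f = refl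
  sumTo-sucˡ (suc n) f = trans (+-congʳ (sumTo-sucˡ n f)) (+-assoc _ _ _)

  sumTo-triangle : ∀ n (h : ℕ → ℕ → Carrier) →
                   sumTo n (λ k → sumTo (n ∸ k) (h k)) ≈ sumTo n (λ K → sumTo K (λ k → h k (K ∸ k)))
  sumTo-triangle zero    h = refl
  sumTo-triangle (suc n) h = begin
    sumTo n (λ k → sumTo (suc n ∸ k) (h k)) + sumTo (n ∸ n) (h (suc n))
      ≈⟨ +-cong (sumTo-cong n (λ k k≤n → reflexive (cong (λ t → sumTo t (h k)) (ℕ.+-∸-assoc 1 k≤n))))
                (reflexive (cong (λ t → sumTo t (h (suc n))) (ℕ.n∸n≡0 n))) ⟩
    sumTo n (λ k → sumTo (n ∸ k) (h k) + h k (suc (n ∸ k))) + h (suc n) 0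
      ≈⟨ +-congʳ (sumTo-distrib-+ n _ _) ⟩
    (sumTo n (λ k → sumTo (n ∸ k) (h k)) + sumTo n (λ k → h k (suc (n ∸ k)))) + h (suc n) 0
      ≈⟨ +-cong (+-cong (sumTo-triangle n h)
                        (sumTo-cong n (λ k k≤n → sym (reflexive (cong (h k) (ℕ.+-∸-assoc 1 k≤n))))))
                (sym (reflexive (cong (h (suc n)) (ℕ.n∸n≡0 n)))) ⟩
    (sumTo n (λ K → sumTo K (λ k → h k (K ∸ k))) + sumTo n (λ k → h k (suc n ∸ k))) + h (suc n) (n ∸ n)
      ≈⟨ +-assoc _ _ _ ⟩
    sumTo n (λ K → sumTo K (λ k → h k (K ∸ k))) + sumTo (suc n) (λ k → h k (suc n ∸ k)) ∎

  pow≡^ : ∀ a n → pow a n ≡ a ^ n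
  pow≡^ a zero    = ≡.refl
  pow≡^ a (suc n) = cong (a *_) (pow≡^ a n)

  pow-homo-* : ∀ a m n → pow a (m ℕ.+ n) ≈ pow a m * pow a n
  pow-homo-* a m n rewrite pow≡^ a (m ℕ.+ n) | pow≡^ a m | pow≡^ a n = ^-homo-* a m n

  pow-distrib-* : ∀ a b n → pow (a * b) n ≈ pow a n * pow b n
  pow-distrib-* a b n rewrite pow≡^ (a * b) n | pow≡^ a n | pow≡^ b n = ^-distrib-* a b n

  pow-congˡ : ∀ {a b} n → a ≈ b → pow a n ≈ pow b n
  pow-congˡ {a} {b} n a≈b rewrite pow≡^ a n | pow≡^ b n = ^-congˡ n a≈b

  pow-1# : ∀ n → pow 1# n ≈ 1#
  pow-1# zero    = refl
  pow-1# (suc n) = trans (*-identityˡ _) (pow-1# n)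

  pow-inverse : ∀ {a b} n → a * b ≈ 1# → pow a n * pow b n ≈ 1#
  pow-inverse {a} {b} n a*b≈1 = trans (sym (pow-distrib-* a b n)) (trans (pow-congˡ n a*b≈1) (pow-1# n))

  qint-+ : ∀ a b → pow q a * qint b + qint a ≈ qint (a ℕ.+ b)
  qint-+ a zero    = trans (+-congʳ (zeroʳ _)) (trans (+-identityˡ _) (sym (reflexive (cong qint (ℕ.+-identityʳ a)))))
  qint-+ a (suc b) = begin
    pow q a * (pow q b + qint b) + qint a               ≈⟨ +-congʳ (distribˡ _ _ _) ⟩
    (pow q a * pow q b + pow q a * qint b) + qint a     ≈⟨ +-assoc _ _ _ ⟩
    pow q a * pow q b + (pow q a * qint b + qint a)     ≈⟨ +-cong (pow-homo-* q a b) (sym (qint-+ a b)) ⟨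
    pow q (a ℕ.+ b) + qint (a ℕ.+ b)                    ≡⟨ cong qint (ℕ.+-suc a b) ⟨
    qint (a ℕ.+ suc b)                                  ∎

  qint-split : ∀ {i N} → i ≤ N → pow q i * qint (N ∸ i) + qint i ≈ qint N
  qint-split {i} i≤N = trans (qint-+ i _) (reflexive (cong qint (ℕ.m+[n∸m]≡n i≤N)))

  qfact-∸ : ∀ {i N} → i < N → qfact (N ∸ i) ≈ qint (N ∸ i) * qfact (N ∸ suc i)
  qfact-∸ {i} {N} i<N rewrite ℕ.+-∸-assoc 1 i<N = refl

  -- The q-binomial coefficient through its Pascal rule; unlike qbinom (whose
  -- truncated subtraction gives junk values), it vanishes above the diagonal.
  gaussBinom : ℕ → ℕ → Carrier
  gaussBinom N       zero    = 1#
  gaussBinom zero    (suc i) = 0#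
  gaussBinom (suc N) (suc i) = pow q (suc i) * gaussBinom N (suc i) + gaussBinom N i

  gaussBinom-vanishes : ∀ N i → N < i → gaussBinom N i ≈ 0#
  gaussBinom-vanishes zero    (suc i) _         = refl
  gaussBinom-vanishes (suc N) (suc i) (s≤s N<i) = begin
    pow q (suc i) * gaussBinom N (suc i) + gaussBinom N i
      ≈⟨ +-cong (*-congˡ (gaussBinom-vanishes N (suc i) (ℕ.m≤n⇒m≤1+n N<i))) (gaussBinom-vanishes N i N<i) ⟩
    pow q (suc i) * 0# + 0#  ≈⟨ trans (+-identityʳ _) (zeroʳ _) ⟩
    0#                       ∎

  gaussBinom-factorial : ∀ N i → i ≤ N → gaussBinom N i * (qfact i * qfact (N ∸ i)) ≈ qfact N
  gaussBinom-suc-factorial : ∀ N i → i ≤ N →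
    gaussBinom N (suc i) * (qfact (suc i) * qfact (N ∸ i)) ≈ qint (N ∸ i) * qfact N

  gaussBinom-factorial N       zero    _         = trans (*-identityˡ _) (*-identityˡ _)
  gaussBinom-factorial (suc N) (suc i) (s≤s i≤N) = begin
    (Q * gaussBinom N (suc i) + gaussBinom N i) * (qfact (suc i) * qfact (N ∸ i))
      ≈⟨ distribʳ _ _ _ ⟩
    Q * gaussBinom N (suc i) * (qfact (suc i) * qfact (N ∸ i)) + gaussBinom N i * (U * qfact i * qfact (N ∸ i))
      ≈⟨ +-cong (trans (*-assoc _ _ _) (*-congˡ (gaussBinom-suc-factorial N i i≤N))) lowerTerm ⟩
    Q * (qint (N ∸ i) * qfact N) + U * qfact N  ≈⟨ +-congʳ (*-assoc _ _ _) ⟨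
    Q * qint (N ∸ i) * qfact N + U * qfact N    ≈⟨ distribʳ _ _ _ ⟨
    (Q * qint (N ∸ i) + U) * qfact N            ≈⟨ *-congʳ (qint-split (s≤s i≤N)) ⟩
    qint (suc N) * qfact N                      ∎
    where
      Q = pow q (suc i)
      U = qint (suc i)
      lowerTerm : gaussBinom N i * (U * qfact i * qfact (N ∸ i)) ≈ U * qfact N
      lowerTerm = trans (solve 4 (λ g u f e → g :* (u :* f :* e) := u :* (g :* (f :* e)))
                                 refl (gaussBinom N i) U (qfact i) (qfact (N ∸ i)))
                        (*-congˡ (gaussBinom-factorial N i i≤N))

  gaussBinom-suc-factorial N i i≤N with ℕ.m≤n⇒m<n∨m≡n i≤N
  ... | inj₁ i<N = begin
    gaussBinom N (suc i) * (qfact (suc i) * qfact (N ∸ i))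
      ≈⟨ *-congˡ (*-congˡ (qfact-∸ i<N)) ⟩
    gaussBinom N (suc i) * (qfact (suc i) * (qint (N ∸ i) * qfact (N ∸ suc i)))
      ≈⟨ solve 4 (λ g f v e → g :* (f :* (v :* e)) := v :* (g :* (f :* e)))
                 refl (gaussBinom N (suc i)) (qfact (suc i)) (qint (N ∸ i)) (qfact (N ∸ suc i)) ⟩
    qint (N ∸ i) * (gaussBinom N (suc i) * (qfact (suc i) * qfact (N ∸ suc i)))
      ≈⟨ *-congˡ (gaussBinom-factorial N (suc i) i<N) ⟩
    qint (N ∸ i) * qfact N ∎
  ... | inj₂ ≡.refl = begin
    gaussBinom i (suc i) * (qfact (suc i) * qfact (i ∸ i))
      ≈⟨ trans (*-congʳ (gaussBinom-vanishes i (suc i) ℕ.≤-refl)) (zeroˡ _) ⟩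
    0#                      ≈⟨ zeroˡ _ ⟨
    qint 0 * qfact i        ≡⟨ cong (λ t → qint t * qfact i) (ℕ.n∸n≡0 i) ⟨
    qint (i ∸ i) * qfact i  ∎

  gaussCoeff : ℕ → ℕ → Carrier
  gaussCoeff N i = gaussBinom N i * (pow (- 1#) i * pow q (choose2 i))

  gaussCoeff-suc : ∀ N i → gaussCoeff (suc N) (suc i) ≈
                   pow q (suc i) * gaussCoeff N (suc i) + - 1# * (pow q i * gaussCoeff N i)
  gaussCoeff-suc N i = begin
    (Q * gaussBinom N (suc i) + B) * (S * P)
      ≈⟨ distribʳ _ _ _ ⟩
    Q * gaussBinom N (suc i) * (S * P) + B * (S * P)
      ≈⟨ +-cong (*-assoc _ _ _) (*-congˡ (*-congˡ (pow-homo-* q i (choose2 i)))) ⟩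
    Q * gaussCoeff N (suc i) + B * (- 1# * pow (- 1#) i * (pow q i * pow q (choose2 i)))
      ≈⟨ +-congˡ (solve 5 (λ b s t u v → b :* (s :* t :* (u :* v)) := s :* (u :* (b :* (t :* v))))
                          refl B (- 1#) (pow (- 1#) i) (pow q i) (pow q (choose2 i))) ⟩
    Q * gaussCoeff N (suc i) + - 1# * (pow q i * gaussCoeff N i) ∎
    where
      Q = pow q (suc i)
      B = gaussBinom N i
      S = pow (- 1#) (suc i)
      P = pow q (choose2 (suc i))

  gaussTerm-suc : ∀ N i x → gaussCoeff (suc N) (suc i) * pow x (suc i) ≈
    gaussCoeff N (suc i) * pow (q * x) (suc i) + - 1# * x * (gaussCoeff N i * pow (q * x) i)
  gaussTerm-suc N i x = begin
    gaussCoeff (suc N) (suc i) * (x * pow x i)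
      ≈⟨ *-congʳ (gaussCoeff-suc N i) ⟩
    (q * Qi * C₁ + - 1# * (Qi * C₀)) * (x * pow x i)
      ≈⟨ solve 6 (λ q u a s b y → (q :* u :* a :+ s :* (u :* b)) :* y := a :* (q :* u :* y) :+ s :* (b :* (u :* y)))
                 refl q Qi C₁ (- 1#) C₀ (x * pow x i) ⟩
    C₁ * (q * Qi * (x * pow x i)) + - 1# * (C₀ * (Qi * (x * pow x i)))
      ≈⟨ +-cong (sym (*-congˡ (pow-distrib-* q x (suc i))))
                (*-congˡ (solve 4 (λ b u x y → b :* (u :* (x :* y)) := x :* (b :* (u :* y))) refl C₀ Qi x (pow x i))) ⟩
    C₁ * pow (q * x) (suc i) + - 1# * (x * (C₀ * (Qi * pow x i)))
      ≈⟨ +-congˡ (trans (*-assoc _ _ _) (*-congˡ (*-congˡ (*-congˡ (pow-distrib-* q x i))))) ⟨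
    C₁ * pow (q * x) (suc i) + - 1# * x * (C₀ * pow (q * x) i) ∎
    where
      Qi = pow q i
      C₁ = gaussCoeff N (suc i)
      C₀ = gaussCoeff N i

  qfall-suc : ∀ N x → qfall x (suc N) ≈ (1# - x) * qfall (q * x) N
  qfall-suc zero    x = trans (*-identityˡ _) (trans (+-congˡ (-‿cong (*-identityʳ x))) (sym (*-identityʳ _)))
  qfall-suc (suc N) x = begin
    qfall x (suc N) * (1# - x * (q * pow q N))
      ≈⟨ *-cong (qfall-suc N x)
                (+-congˡ (-‿cong (solve 3 (λ x q p → x :* (q :* p) := (q :* x) :* p) refl x q (pow q N)))) ⟩
    ((1# - x) * qfall (q * x) N) * (1# - q * x * pow q N)  ≈⟨ *-assoc _ _ _ ⟩
    (1# - x) * (qfall (q * x) N * (1# - q * x * pow q N))  ∎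

  qfall-gauss : ∀ N x → qfall x N ≈ sumTo N (λ i → gaussCoeff N i * pow x i)
  qfall-gauss zero    x = sym (trans (*-identityʳ _) (trans (*-identityˡ _) (*-identityˡ _)))
  qfall-gauss (suc N) x = begin
    qfall x (suc N)                                   ≈⟨ qfall-suc N x ⟩
    (1# - x) * qfall (q * x) N                        ≈⟨ *-cong (+-congˡ (sym (-1*x≈-x x))) (qfall-gauss N (q * x)) ⟩
    (1# + - 1# * x) * sumTo N d                       ≈⟨ trans (distribʳ _ _ _) (+-congʳ (*-identityˡ _)) ⟩
    sumTo N d + - 1# * x * sumTo N d                  ≈⟨ +-cong sumTo-d (*-distribˡ-sumTo N (- 1# * x) d) ⟩
    (1# + sumTo N (λ i → d (suc i))) + sumTo N (λ i → - 1# * x * d i)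
      ≈⟨ trans (+-assoc _ _ _) (+-congˡ (sym (sumTo-distrib-+ N _ _))) ⟩
    1# + sumTo N (λ i → d (suc i) + - 1# * x * d i)  ≈⟨ +-cong term₀ (sumTo-cong N (λ i _ → gaussTerm-suc N i x)) ⟨
    gaussCoeff (suc N) 0 * pow x 0 + sumTo N (λ i → gaussCoeff (suc N) (suc i) * pow x (suc i))
      ≈⟨ sumTo-sucˡ N _ ⟨
    sumTo (suc N) (λ i → gaussCoeff (suc N) i * pow x i) ∎
    where
      d : ℕ → Carrier
      d i = gaussCoeff N i * pow (q * x) i
      term₀ : gaussCoeff (suc N) 0 * pow x 0 ≈ 1#
      term₀ = trans (*-identityʳ _) (trans (*-identityˡ _) (*-identityˡ _))
      -- The sum may be extended by its vanishing term i = N + 1 and then re-indexed.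
      sumTo-d : sumTo N d ≈ 1# + sumTo N (λ i → d (suc i))
      sumTo-d = begin
        sumTo N d                  ≈⟨ +-identityʳ _ ⟨
        sumTo N d + 0#             ≈⟨ +-congˡ (trans (*-congʳ (*-congʳ (gaussBinom-vanishes N (suc N) ℕ.≤-refl)))
                                                     (trans (*-congʳ (zeroˡ _)) (zeroˡ _))) ⟨
        sumTo (suc N) d            ≈⟨ sumTo-sucˡ N d ⟩
        d 0 + sumTo N (λ i → d (suc i))
          ≈⟨ +-congʳ (trans (*-identityʳ _) (trans (*-identityˡ _) (*-identityˡ _))) ⟩
        1# + sumTo N (λ i → d (suc i)) ∎

  stirlingTerm : ℕ → ℕ → ℕ → Carrier
  stirlingTerm m K j = pow (- 1#) (K ∸ j) * (pow q (choose2 (K ∸ j)) * (qbinom K j * pow (qint j) m))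

  stirlingSum : ℕ → ℕ → Carrier
  stirlingSum m K = sumTo K (stirlingTerm m K)

  module _ (qint*ι≈1 : ∀ j → qint (suc j) * ι j ≈ 1#) where

    qfact*qfactInv≈1 : ∀ k → qfact k * qfactInv k ≈ 1#
    qfact*qfactInv≈1 zero    = *-identityˡ _
    qfact*qfactInv≈1 (suc k) = begin
      (qint (suc k) * qfact k) * (ι k * qfactInv k)
        ≈⟨ solve 4 (λ a b d e → (a :* b) :* (d :* e) := (a :* d) :* (b :* e))
                   refl (qint (suc k)) (qfact k) (ι k) (qfactInv k) ⟩
      (qint (suc k) * ι k) * (qfact k * qfactInv k)  ≈⟨ *-cong (qint*ι≈1 k) (qfact*qfactInv≈1 k) ⟩
      1# * 1#                                         ≈⟨ *-identityˡ _ ⟩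
      1#                                              ∎

    cancel-qfact : ∀ a k → a * (qfact k * qfactInv k) ≈ a
    cancel-qfact a k = trans (*-congˡ (qfact*qfactInv≈1 k)) (*-identityʳ a)

    qbinom≈gaussBinom : ∀ {N i} → i ≤ N → qbinom N i ≈ gaussBinom N i
    qbinom≈gaussBinom {N} {i} i≤N = begin
      qfact N * (qfactInv i * qfactInv (N ∸ i))
        ≈⟨ *-congʳ (gaussBinom-factorial N i i≤N) ⟨
      gaussBinom N i * (qfact i * qfact (N ∸ i)) * (qfactInv i * qfactInv (N ∸ i))
        ≈⟨ solve 5 (λ g a b d e → g :* (a :* b) :* (d :* e) := g :* (a :* d) :* (b :* e))
                   refl (gaussBinom N i) (qfact i) (qfact (N ∸ i)) (qfactInv i) (qfactInv (N ∸ i)) ⟩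
      gaussBinom N i * (qfact i * qfactInv i) * (qfact (N ∸ i) * qfactInv (N ∸ i))
        ≈⟨ trans (cancel-qfact _ (N ∸ i)) (cancel-qfact _ i) ⟩
      gaussBinom N i ∎

    qbinom-*-qbinom : ∀ n K k → k ≤ K → K ≤ n →
                      qbinom n k * qbinom (n ∸ k) (K ∸ k) ≈ qbinom n K * qbinom K k
    qbinom-*-qbinom n K k k≤K K≤n = begin
      F n * (I k * I (n ∸ k)) * (F (n ∸ k) * (I (K ∸ k) * I (n ∸ k ∸ (K ∸ k))))
        ≡⟨ cong (λ t → F n * (I k * I (n ∸ k)) * (F (n ∸ k) * (I (K ∸ k) * I t))) n∸k∸[K∸k]≡n∸K ⟩
      F n * (I k * I (n ∸ k)) * (F (n ∸ k) * (I (K ∸ k) * I (n ∸ K)))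
        ≈⟨ solve 6 (λ a b c d e f → a :* (b :* c) :* (d :* (e :* f)) := a :* b :* e :* f :* (d :* c))
                   refl (F n) (I k) (I (n ∸ k)) (F (n ∸ k)) (I (K ∸ k)) (I (n ∸ K)) ⟩
      multinomial * (F (n ∸ k) * I (n ∸ k))  ≈⟨ trans (cancel-qfact _ (n ∸ k)) (sym (cancel-qfact _ K)) ⟩
      multinomial * (F K * I K)
        ≈⟨ solve 6 (λ a b e f g h → a :* b :* e :* f :* (g :* h) := a :* (h :* f) :* (g :* (b :* e)))
                   refl (F n) (I k) (I (K ∸ k)) (I (n ∸ K)) (F K) (I K) ⟩
      F n * (I K * I (n ∸ K)) * (F K * (I k * I (K ∸ k))) ∎
      where
        F = qfact
        I = qfactInv
        multinomial = F n * I k * I (K ∸ k) * I (n ∸ K)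
        n∸k∸[K∸k]≡n∸K : n ∸ k ∸ (K ∸ k) ≡ n ∸ K
        n∸k∸[K∸k]≡n∸K = ≡.trans (ℕ.∸-+-assoc n k (K ∸ k)) (cong (n ∸_) (ℕ.m+[n∸m]≡n k≤K))

    qfall-expansion : ∀ N x → qfall x N ≈ sumTo N (λ i → qbinom N i * (pow (- 1#) i * pow q (choose2 i)) * pow x i)
    qfall-expansion N x =
      trans (qfall-gauss N x) (sumTo-cong N (λ i i≤N → *-congʳ (*-congʳ (sym (qbinom≈gaussBinom i≤N)))))

    qfact*qStirling2 : q * qi ≈ 1# → ∀ m K → qfact K * (pow q (choose2 K) * qStirling2 m K) ≈ stirlingSum m K
    qfact*qStirling2 q*qi≈1 m K = begin
      qfact K * (pow q (choose2 K) * (pow qi (choose2 K) * qfactInv K * stirlingSum m K))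
        ≈⟨ solve 5 (λ f a b i s → f :* (a :* (b :* i :* s)) := s :* (a :* b) :* (f :* i))
                   refl (qfact K) (pow q (choose2 K)) (pow qi (choose2 K)) (qfactInv K) (stirlingSum m K) ⟩
      stirlingSum m K * (pow q (choose2 K) * pow qi (choose2 K)) * (qfact K * qfactInv K)
        ≈⟨ trans (cancel-qfact _ K) (trans (*-congˡ (pow-inverse (choose2 K) q*qi≈1)) (*-identityʳ _)) ⟩
      stirlingSum m K ∎

    bernsteinPow-expansion : ∀ n' m x →
      pow (qint (suc n')) m * bernsteinPow (suc n') m x ≈ sumTo (suc n') (λ K → qbinom (suc n') K * (pow x K * stirlingSum m K))
    bernsteinPow-expansion n' m x = begin
      pow (qint n) m * bernsteinPow n m x          ≈⟨ *-distribˡ-sumTo n _ _ ⟩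
      sumTo n (λ k → pow (qint n) m * bernsteinTerm k)  ≈⟨ sumTo-cong n (λ k _ → bernsteinTerm-expansion k) ⟩
      sumTo n (λ k → sumTo (n ∸ k) (h k))          ≈⟨ sumTo-triangle n h ⟩
      sumTo n (λ K → sumTo K (λ k → h k (K ∸ k)))  ≈⟨ sumTo-cong n antidiagonal ⟩
      sumTo n (λ K → qbinom n K * (pow x K * stirlingSum m K)) ∎
      where
        n = suc n'

        bernsteinTerm : ℕ → Carrier
        bernsteinTerm k = pow (qint k * ι n') m * (qbinom n k * (pow x k * qfall x (n ∸ k)))

        h : ℕ → ℕ → Carrier
        h k i = pow (qint k) m * (qbinom n k * (pow x k * (qbinom (n ∸ k) i * (pow (- 1#) i * pow q (choose2 i)) * pow x i)))

        bernsteinTerm-expansion : ∀ k → pow (qint n) m * bernsteinTerm k ≈ sumTo (n ∸ k) (h k)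
        bernsteinTerm-expansion k = begin
          pow (qint n) m * (pow (qint k * ι n') m * Y)
            ≈⟨ *-congˡ (*-congʳ (pow-distrib-* (qint k) (ι n') m)) ⟩
          pow (qint n) m * (pow (qint k) m * pow (ι n') m * Y)
            ≈⟨ solve 4 (λ p a b y → p :* (a :* b :* y) := a :* y :* (p :* b))
                       refl (pow (qint n) m) (pow (qint k) m) (pow (ι n') m) Y ⟩
          pow (qint k) m * Y * (pow (qint n) m * pow (ι n') m)
            ≈⟨ trans (*-congˡ (pow-inverse m (qint*ι≈1 n'))) (*-identityʳ _) ⟩
          pow (qint k) m * (qbinom n k * (pow x k * qfall x (n ∸ k)))
            ≈⟨ *-congˡ (*-congˡ (*-congˡ (qfall-expansion (n ∸ k) x))) ⟩
          pow (qint k) m * (qbinom n k * (pow x k * sumTo (n ∸ k) _))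
            ≈⟨ *-congˡ (trans (*-congˡ (*-distribˡ-sumTo (n ∸ k) _ _)) (*-distribˡ-sumTo (n ∸ k) _ _)) ⟩
          pow (qint k) m * sumTo (n ∸ k) _
            ≈⟨ *-distribˡ-sumTo (n ∸ k) _ _ ⟩
          sumTo (n ∸ k) (h k) ∎
          where
            Y = qbinom n k * (pow x k * qfall x (n ∸ k))

        h-antidiagonal : ∀ K k → K ≤ n → k ≤ K → h k (K ∸ k) ≈ qbinom n K * (pow x K * stirlingTerm m K k)
        h-antidiagonal K k K≤n k≤K = begin
          g * (qbinom n k * (pow x k * (qbinom (n ∸ k) (K ∸ k) * (S * C) * pow x (K ∸ k))))
            ≈⟨ solve 7 (λ g a y b s c z → g :* (a :* (y :* (b :* (s :* c) :* z))) := a :* b :* (y :* z :* (s :* (c :* g))))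
                       refl g (qbinom n k) (pow x k) (qbinom (n ∸ k) (K ∸ k)) S C (pow x (K ∸ k)) ⟩
          qbinom n k * qbinom (n ∸ k) (K ∸ k) * (pow x k * pow x (K ∸ k) * (S * (C * g)))
            ≈⟨ *-cong (qbinom-*-qbinom n K k k≤K K≤n)
                      (*-congʳ (trans (sym (pow-homo-* x k (K ∸ k))) (reflexive (cong (pow x) (ℕ.m+[n∸m]≡n k≤K))))) ⟩
          qbinom n K * qbinom K k * (pow x K * (S * (C * g)))
            ≈⟨ solve 6 (λ a b y s c g → a :* b :* (y :* (s :* (c :* g))) := a :* (y :* (s :* (c :* (b :* g)))))
                       refl (qbinom n K) (qbinom K k) (pow x K) S C g ⟩
          qbinom n K * (pow x K * stirlingTerm m K k) ∎
          where
            g = pow (qint k) m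
            S = pow (- 1#) (K ∸ k)
            C = pow q (choose2 (K ∸ k))

        antidiagonal : ∀ K → K ≤ n → sumTo K (λ k → h k (K ∸ k)) ≈ qbinom n K * (pow x K * stirlingSum m K)
        antidiagonal K K≤n = begin
          sumTo K (λ k → h k (K ∸ k))
            ≈⟨ sumTo-cong K (λ k → h-antidiagonal K k K≤n) ⟩
          sumTo K (λ k → qbinom n K * (pow x K * stirlingTerm m K k))
            ≈⟨ trans (*-congˡ (*-distribˡ-sumTo K _ _)) (*-distribˡ-sumTo K _ _) ⟨
          qbinom n K * (pow x K * stirlingSum m K) ∎

corollary4 : ∀ {c ℓ : Level} (R : CommutativeRing c ℓ)
    (q qi : CommutativeRing.Carrier R) (ι : ℕ → CommutativeRing.Carrier R) →
    CommutativeRing._≈_ R (CommutativeRing._*_ R q qi) (CommutativeRing.1# R) →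
    (∀ j → CommutativeRing._≈_ R (CommutativeRing._*_ R (QCalc.qint R q qi ι (suc j)) (ι j)) (CommutativeRing.1# R)) →
    (n m : ℕ) → 1 ≤ n → (x : CommutativeRing.Carrier R) →
    CommutativeRing._≈_ R
      (CommutativeRing._*_ R (QCalc.pow R q qi ι (QCalc.qint R q qi ι n) m) (QCalc.bernsteinPow R q qi ι n m x))
      (QCalc.sumTo R q qi ι n (λ k →
        CommutativeRing._*_ R (QCalc.qbinom R q qi ι n k)
          (CommutativeRing._*_ R (QCalc.pow R q qi ι x k)
            (CommutativeRing._*_ R (QCalc.qfact R q qi ι k)
              (CommutativeRing._*_ R (QCalc.pow R q qi ι q (choose2 k)) (QCalc.qStirling2 R q qi ι m k))))))
corollary4 R q qi ι q*qi≈1 qint*ι≈1 (suc n') m (s≤s _) x =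
  trans (bernsteinPow-expansion R q qi ι qint*ι≈1 n' m x)
        (sumTo-cong R q qi ι (suc n') (λ K _ → *-congˡ (*-congˡ (sym (qfact*qStirling2 R q qi ι qint*ι≈1 q*qi≈1 m K)))))
  where open CommutativeRing R using (trans; sym; *-congˡ)
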